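{- Let $G=(V,E)$ be a bipartite graph with $d$ nodes in which every node has degree at least $2$. Then the vertex $\mathbf{0}_d$ is the unique simple vertex of $\mathrm{STAB}(G)$, i.e. $\mathbf{0}_d$ is the only vertex of $\mathrm{STAB}(G)$ contained in exactly $d$ facets of $\mathrm{STAB}(G)$.
   Context: The stable set polytope $\mathrm{STAB}(G)\subseteq\mathbb{R}^V\cong\mathbb{R}^d$ is the convex hull of the characteristic vectors of the stable sets of $G$.
   Formalization: The polytope $\mathrm{STAB}(G)$ is taken in ℚ^d instead of $\mathbb{R}^d$, so its points, its vertices and the inequalities defining its facets have rational coordinates and coefficients. -}

module Defs where

open import Data.Nat using (ℕ; zero; suc)
open import Data.Fin using (Fin; zero; suc)
open import Data.Bool using (Bool; true; false)
open import Data.Rational using (ℚ; 0ℚ; 1ℚ; _+_; _*_; _-_; _≤_; _<_)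
open import Data.Product using (Σ; ∃; _×_; _,_)
open import Data.Unit using (⊤)
open import Relation.Nullary using (¬_)
open import Relation.Binary.PropositionalEquality using (_≡_; _≢_)

record Graph (d : ℕ) : Set₁ where
  field
    Adj    : Fin d → Fin d → Set
    sym    : ∀ {u v} → Adj u v → Adj v u
    irrefl : ∀ {u} → ¬ Adj u u

open Graph public

Bipartite : ∀ {d} → Graph d → Set
Bipartite {d} G = Σ (Fin d → Bool) λ c → ∀ u v → Adj G u v → c u ≢ c v

MinDegree≥2 : ∀ {d} → Graph d → Set
MinDegree≥2 {d} G =
  ∀ v → Σ (Fin d) λ u → Σ (Fin d) λ w → u ≢ w × Adj G v u × Adj G v w

Point : ℕ → Set
Point d = Fin d → ℚ

sumFin : ∀ {k} → (Fin k → ℚ) → ℚ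
sumFin {zero}  f = 0ℚ
sumFin {suc k} f = f zero + sumFin {k} (λ j → f (suc j))

dot : ∀ {d} → Point d → Point d → ℚ
dot a x = sumFin (λ i → a i * x i)

zeroPt : ∀ d → Point d
zeroPt d i = 0ℚ

Region : ℕ → Set₁
Region d = Point d → Set

IsStable : ∀ {d} → Graph d → (Fin d → Bool) → Set
IsStable {d} G S = ∀ u v → Adj G u v → ¬ (S u ≡ true × S v ≡ true)

χ : ∀ {d} → (Fin d → Bool) → Point d
χ S i with S i
... | true  = 1ℚ
... | false = 0ℚ

-- STAB(G): convex hull of characteristic vectors of stable sets
STAB : ∀ {d} → Graph d → Region d
STAB {d} G x =
  Σ ℕ λ k →
  Σ (Fin k → Fin d → Bool) λ S →
  (∀ j → IsStable G (S j)) ×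
  Σ (Fin k → ℚ) λ c →
  (∀ j → 0ℚ ≤ c j) ×
  (sumFin c ≡ 1ℚ) ×
  (∀ i → x i ≡ sumFin (λ j → c j * χ (S j) i))

IsVertex : ∀ {d} → Region d → Point d → Set
IsVertex {d} P x =
  P x ×
  (∀ (y z : Point d) (t : ℚ) → P y → P z → 0ℚ < t → t < 1ℚ →
     (∀ i → x i ≡ t * y i + (1ℚ - t) * z i) → ∀ i → y i ≡ z i)

ValidIneq : ∀ {d} → Region d → Point d → ℚ → Set
ValidIneq P a b = ∀ y → P y → dot a y ≤ b

Face : ∀ {d} → Region d → Point d → ℚ → Region d
Face P a b y = P y × dot a y ≡ b

LinIndep : ∀ {d k} → (Fin k → Point d) → Set
LinIndep {d} {k} v =
  ∀ (c : Fin k → ℚ) → (∀ i → sumFin (λ j → c j * v j i) ≡ 0ℚ) → ∀ j → c j ≡ 0ℚ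

AffIndep : ∀ {d k} → (Fin (suc k) → Point d) → Set
AffIndep p = LinIndep (λ j i → p (suc j) i - p zero i)

-- F contains n affinely independent points (i.e. dim F ≥ n - 1)
HasAffIndep : ∀ {d} → Region d → ℕ → Set
HasAffIndep F zero = ⊤
HasAffIndep {d} F (suc k) =
  Σ (Fin (suc k) → Point d) λ p → (∀ j → F (p j)) × AffIndep p

IsFacet : ∀ {d} → Region d → Point d → ℚ → Set
IsFacet {d} P a b =
  ValidIneq P a b × HasAffIndep (Face P a b) d × ¬ HasAffIndep (Face P a b) (suc d)

SameSet : ∀ {d} → Region d → Region d → Set
SameSet {d} F F' = ∀ (y : Point d) → (F y → F' y) × (F' y → F y)

InExactlyFacets : ∀ {d} → Region d → Point d → ℕ → Set
InExactlyFacets {d} P x n =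
  Σ (Fin n → Point d × ℚ) λ fs →
  (∀ j → let (a , b) = fs j in IsFacet P a b × Face P a b x) ×
  (∀ j j' → let (a , b) = fs j ; (a' , b') = fs j' in
     SameSet (Face P a b) (Face P a' b') → j ≡ j') ×
  (∀ a b → IsFacet P a b → Face P a b x →
     ∃ λ j → let (a' , b') = fs j in SameSet (Face P a b) (Face P a' b'))

IsSimpleVertex : ∀ {d} → Region d → Point d → Set
IsSimpleVertex {d} P x = IsVertex P x × InExactlyFacets P x d

module Submission where

-- The origin is a vertex (all points of STAB(G) are nonnegative), and the facets through it
-- are exactly the d nonnegativity facets -y_i ≤ 0: a facet a·y ≤ b through 0 has b = 0 and
-- a ≤ 0; if a had two nonzero entries its face would lie in two coordinate hyperplanes and be
-- too small, and a = 0 would make the face all of the full-dimensional STAB(G).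
--
-- Conversely, every vertex x of STAB(G) is the characteristic vector of a stable set S.  If
-- x ≠ 0, pick i ∈ S.  Each node l lies on a facet through x: the nonnegativity facet of l if
-- l ∉ S, and the edge facet y_l + y_n ≤ 1 for a neighbour n of l if l ∈ S (edge inequalities
-- define facets because G is bipartite).  Since i has two neighbours, a second edge facet at i
-- gives d + 1 distinct facets through x, so x is not simple.

open import Defs hiding (sym)
open import Data.Nat as ℕ using (ℕ; zero; suc; s≤s)
import Data.Nat.Properties as ℕ
open import Data.Fin using (Fin; zero; suc; punchIn; punchOut)
open import Data.Fin.Properties
  using (punchInᵢ≢i; punchIn-punchOut; punchIn-injective; pigeonhole; any?)
  renaming (_≟_ to _≟ᶠ_; <⇒≢ to <⇒≢ᶠ)
open import Data.Bool using (Bool; true; false; _∨_)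
open import Data.Bool.Properties using () renaming (_≟_ to _≟ᵇ_)
open import Data.Rational
  using (ℚ; 0ℚ; 1ℚ; _+_; _*_; _-_; -_; _≤_; _<_; 1/_; NonZero; Positive; nonNegative; positive; ≢-nonZero)
open import Data.Rational.Properties
open import Data.Rational.Solver using (module +-*-Solver)
open import Data.Product using (Σ; ∃; _×_; _,_; proj₁; proj₂)
open import Data.Sum using (_⊎_; inj₁; inj₂)
open import Function using (_∘_)
open import Data.Unit using (tt)
open import Relation.Nullary using (¬_; yes; no; ¬?; contradiction)
open import Relation.Nullary.Decidable using (decidable-stable; _×-dec_)
open import Relation.Binary.PropositionalEquality
open import Data.Vec.Functional using (insertAt)
open import Data.Vec.Functional.Properties using (insertAt-lookup; insertAt-punchIn)

open +-*-Solver

0≤1 : 0ℚ ≤ 1ℚ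
0≤1 = <⇒≤ (positive⁻¹ 1ℚ)

*-nonNeg : ∀ {a b} → 0ℚ ≤ a → 0ℚ ≤ b → 0ℚ ≤ a * b
*-nonNeg {a} {b} 0≤a 0≤b =
  nonNegative⁻¹ (a * b) {{nonNeg*nonNeg⇒nonNeg a {{nonNegative 0≤a}} b {{nonNegative 0≤b}}}}

≤-+-nonNeg : ∀ {a b} → 0ℚ ≤ b → a ≤ a + b
≤-+-nonNeg {a} {b} 0≤b = subst (_≤ a + b) (+-identityʳ a) (+-monoʳ-≤ a 0≤b)

nonNeg-sum-zeroˡ : ∀ {a b} → 0ℚ ≤ a → 0ℚ ≤ b → a + b ≡ 0ℚ → a ≡ 0ℚ
nonNeg-sum-zeroˡ {a} {b} 0≤a 0≤b a+b≡0 = ≤-antisym (subst (a ≤_) a+b≡0 (≤-+-nonNeg 0≤b)) 0≤a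

nonNeg-sum-zeroʳ : ∀ {a b} → 0ℚ ≤ a → 0ℚ ≤ b → a + b ≡ 0ℚ → b ≡ 0ℚ
nonNeg-sum-zeroʳ {a} {b} 0≤a 0≤b a+b≡0 = nonNeg-sum-zeroˡ 0≤b 0≤a (trans (+-comm b a) a+b≡0)

*-cancel-nonZero : ∀ {a y} → a ≢ 0ℚ → a * y ≡ 0ℚ → y ≡ 0ℚ
*-cancel-nonZero {a} {y} a≢0 ay≡0 = begin
  y                ≡⟨ sym (*-identityˡ y) ⟩
  1ℚ * y           ≡⟨ cong (_* y) (sym (*-inverseˡ a)) ⟩
  (1/ a) * a * y   ≡⟨ *-assoc (1/ a) a y ⟩
  (1/ a) * (a * y) ≡⟨ cong ((1/ a) *_) ay≡0 ⟩
  (1/ a) * 0ℚ      ≡⟨ *-zeroʳ (1/ a) ⟩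
  0ℚ               ∎
  where open ≡-Reasoning
        instance _ = ≢-nonZero a≢0

≤∧≢⇒< : ∀ {a b} → a ≤ b → a ≢ b → a < b
≤∧≢⇒< {a} {b} a≤b a≢b with b ≤? a
... | yes b≤a = contradiction (≤-antisym a≤b b≤a) a≢b
... | no b≰a = ≰⇒> b≰a

1-pos : ∀ {t} → t < 1ℚ → 0ℚ < 1ℚ - t
1-pos {t} t<1 = <-respˡ-≡ (+-inverseʳ t) (+-monoˡ-< (- t) t<1)

sum-cong : ∀ {k} {f g : Fin k → ℚ} → (∀ j → f j ≡ g j) → sumFin f ≡ sumFin g
sum-cong {zero}  f≡g = refl
sum-cong {suc k} f≡g = cong₂ _+_ (f≡g zero) (sum-cong (λ j → f≡g (suc j)))

sum-zero : ∀ {k} {f : Fin k → ℚ} → (∀ j → f j ≡ 0ℚ) → sumFin f ≡ 0ℚ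
sum-zero {zero}  f≡0 = refl
sum-zero {suc k} f≡0 = trans (cong₂ _+_ (f≡0 zero) (sum-zero (λ j → f≡0 (suc j)))) (+-identityʳ 0ℚ)

sum-+ : ∀ {k} (f g : Fin k → ℚ) → sumFin (λ j → f j + g j) ≡ sumFin f + sumFin g
sum-+ {zero}  f g = refl
sum-+ {suc k} f g =
  trans (cong ((f zero + g zero) +_) (sum-+ (λ j → f (suc j)) (λ j → g (suc j))))
        (solve 4 (λ a b c e → (a :+ b) :+ (c :+ e) := (a :+ c) :+ (b :+ e)) refl (f zero) (g zero) _ _)

sum-*ˡ : ∀ {k} (a : ℚ) (f : Fin k → ℚ) → sumFin (λ j → a * f j) ≡ a * sumFin f
sum-*ˡ {zero}  a f = sym (*-zeroʳ a)
sum-*ˡ {suc k} a f =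
  trans (cong (a * f zero +_) (sum-*ˡ a (λ j → f (suc j)))) (sym (*-distribˡ-+ a _ _))

sum-*ʳ : ∀ {k} (a : ℚ) (f : Fin k → ℚ) → sumFin (λ j → f j * a) ≡ sumFin f * a
sum-*ʳ a f = trans (sum-cong (λ j → *-comm (f j) a)) (trans (sum-*ˡ a f) (*-comm a _))

sum-neg : ∀ {k} (f : Fin k → ℚ) → sumFin (λ j → - f j) ≡ - sumFin f
sum-neg f = trans (sum-cong (λ j → solve 1 (λ x → :- x := con (- 1ℚ) :* x) refl (f j)))
  (trans (sum-*ˡ (- 1ℚ) f) (solve 1 (λ x → con (- 1ℚ) :* x := :- x) refl _))

sum-linear : ∀ {k} (β : ℚ) (f g : Fin k → ℚ) →
  sumFin (λ j → f j + β * g j) ≡ sumFin f + β * sumFin g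
sum-linear β f g = trans (sum-+ f (λ j → β * g j)) (cong (sumFin f +_) (sum-*ˡ β g))

sum-nonNeg : ∀ {k} {f : Fin k → ℚ} → (∀ j → 0ℚ ≤ f j) → 0ℚ ≤ sumFin f
sum-nonNeg {zero}  f≥0 = ≤-refl
sum-nonNeg {suc k} f≥0 = +-mono-≤ (f≥0 zero) (sum-nonNeg (λ j → f≥0 (suc j)))

sum-mono : ∀ {k} {f g : Fin k → ℚ} → (∀ j → f j ≤ g j) → sumFin f ≤ sumFin g
sum-mono {zero}  f≤g = ≤-refl
sum-mono {suc k} f≤g = +-mono-≤ (f≤g zero) (sum-mono (λ j → f≤g (suc j)))

sum-nonNeg-zero : ∀ {k} {f : Fin k → ℚ} → (∀ j → 0ℚ ≤ f j) → sumFin f ≡ 0ℚ → ∀ j → f j ≡ 0ℚ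
sum-nonNeg-zero {suc k} f≥0 Σ≡0 zero =
  nonNeg-sum-zeroˡ (f≥0 zero) (sum-nonNeg (λ j → f≥0 (suc j))) Σ≡0
sum-nonNeg-zero {suc k} f≥0 Σ≡0 (suc j) =
  sum-nonNeg-zero (λ j → f≥0 (suc j)) (nonNeg-sum-zeroʳ (f≥0 zero) (sum-nonNeg (λ j → f≥0 (suc j))) Σ≡0) j

sum-punchIn : ∀ {k} (i : Fin (suc k)) (f : Fin (suc k) → ℚ) →
  sumFin f ≡ f i + sumFin (λ j → f (punchIn i j))
sum-punchIn zero    f = refl
sum-punchIn {suc k} (suc i) f =
  trans (cong (f zero +_) (sum-punchIn i (λ j → f (suc j))))
        (solve 3 (λ a b c → a :+ (b :+ c) := b :+ (a :+ c)) refl (f zero) (f (suc i)) _)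

term≤sum : ∀ {k} {f : Fin k → ℚ} → (∀ j → 0ℚ ≤ f j) → ∀ j → f j ≤ sumFin f
term≤sum {suc k} {f} f≥0 j =
  subst (f j ≤_) (sym (sum-punchIn j f)) (≤-+-nonNeg (sum-nonNeg (λ l → f≥0 (punchIn j l))))

sum-single : ∀ {k} (i : Fin k) (f : Fin k → ℚ) → (∀ l → l ≢ i → f l ≡ 0ℚ) → sumFin f ≡ f i
sum-single {suc k} i f offSupport =
  trans (sum-punchIn i f)
    (trans (cong (f i +_) (sum-zero (λ j → offSupport (punchIn i j) (punchInᵢ≢i i j))))
           (+-identityʳ (f i)))

weightOne-others : ∀ {k} {c : Fin k → ℚ} → (∀ l → 0ℚ ≤ c l) → sumFin c ≡ 1ℚ →
  ∀ j → c j ≡ 1ℚ → ∀ l → l ≢ j → c l ≡ 0ℚ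
weightOne-others {suc k} {c} c≥0 Σc≡1 j cⱼ≡1 l l≢j =
  subst (λ m → c m ≡ 0ℚ) (punchIn-punchOut j≢l) (sum-nonNeg-zero (λ l → c≥0 (punchIn j l)) R≡0 (punchOut j≢l))
  where
    j≢l : j ≢ l
    j≢l j≡l = l≢j (sym j≡l)
    R : ℚ
    R = sumFin (λ l → c (punchIn j l))
    R≡0 : R ≡ 0ℚ
    R≡0 = begin
      R             ≡⟨ solve 2 (λ t R → R := t :+ R :- t) refl (c j) R ⟩
      c j + R - c j ≡⟨ cong₂ _-_ (trans (sym (sum-punchIn j c)) Σc≡1) cⱼ≡1 ⟩
      1ℚ - 1ℚ       ≡⟨ +-inverseʳ 1ℚ ⟩
      0ℚ            ∎
      where open ≡-Reasoning

sum-swap : ∀ {k m} (f : Fin k → Fin m → ℚ) →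
  sumFin (λ j → sumFin (f j)) ≡ sumFin (λ l → sumFin (λ j → f j l))
sum-swap {zero} {m} f = sym (sum-zero {m} (λ l → refl))
sum-swap {suc k} f =
  trans (cong (sumFin (f zero) +_) (sum-swap (λ j → f (suc j))))
        (sym (sum-+ (f zero) (λ l → sumFin (λ j → f (suc j) l))))

nonZero-or-zero : ∀ {k} (f : Fin k → ℚ) → (∃ λ j → f j ≢ 0ℚ) ⊎ (∀ j → f j ≡ 0ℚ)
nonZero-or-zero f with any? (λ j → ¬? (f j ≟ 0ℚ))
... | yes witness = inj₁ witness
... | no none = inj₂ (λ j → decidable-stable (f j ≟ 0ℚ) (λ fj≢0 → none (j , fj≢0)))

nonZero-elsewhere : ∀ {k} (f : Fin k → ℚ) (i : Fin k) →
  (∃ λ l → l ≢ i × f l ≢ 0ℚ) ⊎ (∀ l → l ≢ i → f l ≡ 0ℚ)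
nonZero-elsewhere f i with any? (λ l → ¬? (l ≟ᶠ i) ×-dec ¬? (f l ≟ 0ℚ))
... | yes witness = inj₁ witness
... | no none = inj₂ (λ l l≢i → decidable-stable (f l ≟ 0ℚ) (λ fₗ≢0 → none (l , l≢i , fₗ≢0)))

bit : Bool → ℚ
bit true  = 1ℚ
bit false = 0ℚ

χ≡bit : ∀ {d} (S : Fin d → Bool) l → χ S l ≡ bit (S l)
χ≡bit S l with S l
... | true  = refl
... | false = refl

χ-true : ∀ {d} (S : Fin d → Bool) {l} → S l ≡ true → χ S l ≡ 1ℚ
χ-true S {l} Sl = trans (χ≡bit S l) (cong bit Sl)

χ-false : ∀ {d} (S : Fin d → Bool) {l} → S l ≡ false → χ S l ≡ 0ℚ
χ-false S {l} Sl = trans (χ≡bit S l) (cong bit Sl)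

χ-nonNeg : ∀ {d} (S : Fin d → Bool) l → 0ℚ ≤ χ S l
χ-nonNeg S l = subst (0ℚ ≤_) (sym (χ≡bit S l)) (bit-nonNeg (S l))
  where bit-nonNeg : ∀ b → 0ℚ ≤ bit b
        bit-nonNeg true  = 0≤1
        bit-nonNeg false = ≤-refl

singleton : ∀ {d} → Fin d → Fin d → Bool
singleton i l with i ≟ᶠ l
... | yes _ = true
... | no _  = false

singleton-self : ∀ {d} (i : Fin d) → singleton i i ≡ true
singleton-self i with i ≟ᶠ i
... | yes _   = refl
... | no i≢i = contradiction refl i≢i

singleton-other : ∀ {d} {i l : Fin d} → i ≢ l → singleton i l ≡ false
singleton-other {i = i} {l} i≢l with i ≟ᶠ l
... | yes i≡l = contradiction i≡l i≢l
... | no _    = refl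

singleton-member : ∀ {d} {i l : Fin d} → singleton i l ≡ true → i ≡ l
singleton-member {i = i} {l} _  with i ≟ᶠ l
singleton-member             _  | yes i≡l = i≡l
singleton-member             () | no _

unit : ∀ {d} → Fin d → Point d
unit i = χ (singleton i)

unit-self : ∀ {d} (i : Fin d) → unit i i ≡ 1ℚ
unit-self i = χ-true (singleton i) (singleton-self i)

unit-other : ∀ {d} {i l : Fin d} → i ≢ l → unit i l ≡ 0ℚ
unit-other i≢l = χ-false (singleton _) (singleton-other i≢l)

-- the normal vector -e_i of the nonnegativity inequality -y_i ≤ 0
negUnit : ∀ {d} → Fin d → Point d
negUnit i l = - unit i l

-- the normal vector e_u + e_w of the edge inequality y_u + y_w ≤ 1
edgeVec : ∀ {d} → Fin d → Fin d → Point d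
edgeVec u w l = unit u l + unit w l

dot-zero : ∀ {d} (a : Point d) → dot a (zeroPt d) ≡ 0ℚ
dot-zero a = sum-zero (λ i → *-zeroʳ (a i))

dot-unitʳ : ∀ {d} (a : Point d) p → dot a (unit p) ≡ a p
dot-unitʳ a p =
  trans (sum-single p _ (λ l l≢p → trans (cong (a l *_) (unit-other (λ p≡l → l≢p (sym p≡l)))) (*-zeroʳ (a l))))
        (trans (cong (a p *_) (unit-self p)) (*-identityʳ (a p)))

dot-unitˡ : ∀ {d} (i : Fin d) (y : Point d) → dot (unit i) y ≡ y i
dot-unitˡ i y =
  trans (sum-single i _ (λ l l≢i → trans (cong (_* y l) (unit-other (λ i≡l → l≢i (sym i≡l)))) (*-zeroˡ (y l))))
        (trans (cong (_* y i) (unit-self i)) (*-identityˡ (y i)))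

dot-negUnit : ∀ {d} (i : Fin d) (y : Point d) → dot (negUnit i) y ≡ - y i
dot-negUnit i y =
  trans (sum-cong (λ l → sym (neg-distribˡ-* (unit i l) (y l))))
        (trans (sum-neg (λ l → unit i l * y l)) (cong -_ (dot-unitˡ i y)))

dot-edgeVec : ∀ {d} (u w : Fin d) (y : Point d) → dot (edgeVec u w) y ≡ y u + y w
dot-edgeVec u w y =
  trans (sum-cong (λ l → *-distribʳ-+ (y l) (unit u l) (unit w l)))
        (trans (sum-+ (λ l → unit u l * y l) (λ l → unit w l * y l))
               (cong₂ _+_ (dot-unitˡ u y) (dot-unitˡ w y)))

dot-sub : ∀ {d} (a x y : Point d) → dot a (λ l → x l - y l) ≡ dot a x - dot a y
dot-sub a x y =
  trans (sum-cong (λ l → trans (*-distribˡ-+ (a l) (x l) (- y l)) (cong (a l * x l +_) (sym (neg-distribʳ-* (a l) (y l))))))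
        (trans (sum-+ (λ l → a l * x l) (λ l → - (a l * y l))) (cong (dot a x +_) (sum-neg (λ l → a l * y l))))

-- Linear independence: deleting coordinates, elimination, and triangular families

combo : ∀ {k m} → (Fin k → ℚ) → (Fin k → Point m) → Point m
combo c v x = sumFin (λ j → c j * v j x)

dot-combo : ∀ {k m} (a : Point m) (c : Fin k → ℚ) (v : Fin k → Point m) →
  dot a (combo c v) ≡ sumFin (λ j → c j * dot a (v j))
dot-combo a c v = begin
  sumFin (λ l → a l * sumFin (λ j → c j * v j l))           ≡⟨ sum-cong (λ l → sym (sum-*ˡ (a l) (λ j → c j * v j l))) ⟩
  sumFin (λ l → sumFin (λ j → a l * (c j * v j l)))         ≡⟨ sym (sum-swap (λ j l → a l * (c j * v j l))) ⟩
  sumFin (λ j → sumFin (λ l → a l * (c j * v j l)))         ≡⟨ sum-cong (λ j → sum-cong (λ l → reassociate (a l) (c j) (v j l))) ⟩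
  sumFin (λ j → sumFin (λ l → c j * (a l * v j l)))         ≡⟨ sum-cong (λ j → sum-*ˡ (c j) (λ l → a l * v j l)) ⟩
  sumFin (λ j → c j * dot a (v j))                          ∎
  where
    open ≡-Reasoning
    reassociate : ∀ α γ x → α * (γ * x) ≡ γ * (α * x)
    reassociate = solve 3 (λ α γ x → α :* (γ :* x) := γ :* (α :* x)) refl

dropCoordinate : ∀ {k m} (v : Fin k → Point (suc m)) (i : Fin (suc m)) →
  (∀ c → (∀ l → combo c v (punchIn i l) ≡ 0ℚ) → combo c v i ≡ 0ℚ) →
  LinIndep v → LinIndep (λ j l → v j (punchIn i l))
dropCoordinate v i determined indep c othersVanish = indep c allVanish
  where
    allVanish : ∀ x → combo c v x ≡ 0ℚ
    allVanish x with i ≟ᶠ x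
    ... | yes refl = determined c othersVanish
    ... | no i≢x   = subst (λ y → combo c v y ≡ 0ℚ) (punchIn-punchOut i≢x) (othersVanish (punchOut i≢x))

dropZeroCoordinate : ∀ {k m} (v : Fin k → Point (suc m)) (i : Fin (suc m)) →
  (∀ j → v j i ≡ 0ℚ) → LinIndep v → LinIndep (λ j l → v j (punchIn i l))
dropZeroCoordinate v i vanish =
  dropCoordinate v i (λ c _ → sum-zero (λ j → trans (cong (c j *_) (vanish j)) (*-zeroʳ (c j))))

shear : ∀ {k m} (v : Fin (suc k) → Point m) (p : Fin (suc k)) (α : Fin k → ℚ) →
  LinIndep v → LinIndep (λ j x → v (punchIn p j) x - α j * v p x)
shear v p α indep γ vanish j =
  trans (sym (insertAt-punchIn γ p g j)) (indep (insertAt γ p g) lifted (punchIn p j))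
  where
    T g : ℚ
    T = sumFin (λ j → γ j * α j)
    g = - T
    lifted : ∀ x → combo (insertAt γ p g) v x ≡ 0ℚ
    lifted x = begin
      combo (insertAt γ p g) v x
        ≡⟨ sum-punchIn p (λ j → insertAt γ p g j * v j x) ⟩
      insertAt γ p g p * B + sumFin (λ j → insertAt γ p g (punchIn p j) * v (punchIn p j) x)
        ≡⟨ cong₂ _+_ (cong (_* B) (insertAt-lookup γ p g))
                     (sum-cong (λ j → cong (_* v (punchIn p j) x) (insertAt-punchIn γ p g j))) ⟩
      g * B + sumFin (λ j → γ j * v (punchIn p j) x)
        ≡⟨ solve 3 (λ t b s → (:- t) :* b :+ s := s :+ (:- b) :* t) refl T B _ ⟩
      sumFin (λ j → γ j * v (punchIn p j) x) + (- B) * T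
        ≡⟨ sym (sum-linear (- B) (λ j → γ j * v (punchIn p j) x) (λ j → γ j * α j)) ⟩
      sumFin (λ j → γ j * v (punchIn p j) x + (- B) * (γ j * α j))
        ≡⟨ sum-cong (λ j → solve 4 (λ g y a b → g :* y :+ (:- b) :* (g :* a) := g :* (y :- a :* b)) refl
                                    (γ j) (v (punchIn p j) x) (α j) B) ⟩
      combo γ (λ j x → v (punchIn p j) x - α j * v p x) x
        ≡⟨ vanish x ⟩
      0ℚ ∎
      where open ≡-Reasoning
            B : ℚ
            B = v p x

-- More than m vectors in ℚ^m are linearly dependent: either all first coordinates vanish and
-- can be deleted, or a pivot v_p clears the first coordinate of the other vectors.
indep-bound : ∀ {k m} → m ℕ.< k → (v : Fin k → Point m) → ¬ LinIndep v
indep-bound {suc k} {zero}  _ v indep = 1≢0 (indep (λ _ → 1ℚ) (λ ()) zero)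
indep-bound {suc k} {suc m} (s≤s m<k) v indep with nonZero-or-zero (λ j → v j zero)
... | inj₂ firstZero =
  indep-bound (ℕ.m<n⇒m<1+n m<k) (λ j l → v j (suc l)) (dropZeroCoordinate v zero firstZero indep)
... | inj₁ (p , vp≢0) =
  indep-bound m<k (λ j l → w j (suc l)) (dropZeroCoordinate w zero cleared (shear v p α indep))
  where
    instance _ = ≢-nonZero vp≢0
    α : Fin k → ℚ
    α j = v (punchIn p j) zero * 1/ (v p zero)
    w : Fin k → Point (suc m)
    w j x = v (punchIn p j) x - α j * v p x
    cleared : ∀ j → w j zero ≡ 0ℚ
    cleared j = begin
      y - y * r * P    ≡⟨ cong (_-_ y) (*-assoc y r P) ⟩
      y - y * (r * P)  ≡⟨ cong (λ q → y - y * q) (*-inverseˡ P) ⟩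
      y - y * 1ℚ       ≡⟨ cong (_-_ y) (*-identityʳ y) ⟩
      y - y            ≡⟨ +-inverseʳ y ⟩
      0ℚ               ∎
      where open ≡-Reasoning
            y P r : ℚ
            y = v (punchIn p j) zero
            P = v p zero
            r = 1/ P

pivot-coefficient : ∀ {k m} (v : Fin k → Point m) (c : Fin k → ℚ) → (∀ x → combo c v x ≡ 0ℚ) →
  ∀ j x → v j x ≡ 1ℚ → (∀ j' → j' ≢ j → c j' * v j' x ≡ 0ℚ) → c j ≡ 0ℚ
pivot-coefficient v c vanish j x one othersVanish = begin
  c j              ≡⟨ sym (*-identityʳ (c j)) ⟩
  c j * 1ℚ         ≡⟨ cong (c j *_) (sym one) ⟩
  c j * v j x      ≡⟨ sym (sum-single j (λ j' → c j' * v j' x) othersVanish) ⟩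
  combo c v x      ≡⟨ vanish x ⟩
  0ℚ               ∎
  where open ≡-Reasoning

diagonal : ∀ {k m} (v : Fin k → Point m) (π : Fin k → Fin m) →
  (∀ j → v j (π j) ≡ 1ℚ) → (∀ j j' → j' ≢ j → v j' (π j) ≡ 0ℚ) → LinIndep v
diagonal v π one zeros c vanish j =
  pivot-coefficient v c vanish j (π j) (one j)
    (λ j' j'≢j → trans (cong (c j' *_) (zeros j j' j'≢j)) (*-zeroʳ (c j')))

almostDiagonal : ∀ {k m} (v : Fin k → Point m) (π : Fin k → Fin m) (j₀ : Fin k) →
  (∀ j → v j (π j) ≡ 1ℚ) → (∀ j j' → j ≢ j₀ → j' ≢ j → v j' (π j) ≡ 0ℚ) → LinIndep v
almostDiagonal v π j₀ one zeros c vanish = coefficient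
  where
    offColumn : ∀ j → j ≢ j₀ → c j ≡ 0ℚ
    offColumn j j≢j₀ = pivot-coefficient v c vanish j (π j) (one j)
      (λ j' j'≢j → trans (cong (c j' *_) (zeros j j' j≢j₀ j'≢j)) (*-zeroʳ (c j')))
    coefficient : ∀ j → c j ≡ 0ℚ
    coefficient j with j ≟ᶠ j₀
    ... | no j≢j₀  = offColumn j j≢j₀
    ... | yes refl = pivot-coefficient v c vanish j (π j) (one j)
      (λ j' j'≢j → trans (cong (_* v j' (π j)) (offColumn j' j'≢j)) (*-zeroˡ (v j' (π j))))

-- Dimension bounds: regions inside hyperplanes contain few affinely independent points

differences : ∀ {d k} → (Fin (suc k) → Point d) → Fin k → Point d
differences p j i = p (suc j) i - p zero i

affIndep-bound : ∀ {m} (F : Region m) → ¬ HasAffIndep F (suc (suc m))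
affIndep-bound {m} F (p , _ , indep) = indep-bound (ℕ.n<1+n m) (differences p) indep

Forget : ∀ {m} → Fin (suc m) → Region (suc m) → Region m
Forget {m} i F z = Σ (Point (suc m)) λ y → F y × (∀ l → z l ≡ y (punchIn i l))

-- If F lies in a hyperplane a · y = b with a_i ≠ 0, then deleting coordinate i keeps affinely
-- independent points of F independent: coordinate i is determined by the others.
hyperplane-forget : ∀ {m} (F : Region (suc m)) (a : Point (suc m)) (b : ℚ) (i : Fin (suc m)) →
  a i ≢ 0ℚ → (∀ y → F y → dot a y ≡ b) → ∀ {n} → HasAffIndep F n → HasAffIndep (Forget i F) n
hyperplane-forget F a b i aᵢ≢0 inH {zero}  _                 = tt
hyperplane-forget {m} F a b i aᵢ≢0 inH {suc n} (p , p∈F , indep) =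
  (λ j l → p j (punchIn i l)) , (λ j → p j , p∈F j , λ l → refl) ,
  dropCoordinate v i determined indep
  where
    v : Fin n → Point (suc m)
    v = differences p
    normal : ∀ j → dot a (v j) ≡ 0ℚ
    normal j = trans (dot-sub a (p (suc j)) (p zero))
                     (trans (cong₂ _-_ (inH _ (p∈F (suc j))) (inH _ (p∈F zero))) (+-inverseʳ b))
    determined : ∀ c → (∀ l → combo c v (punchIn i l) ≡ 0ℚ) → combo c v i ≡ 0ℚ
    determined c rest = *-cancel-nonZero aᵢ≢0 (begin
      a i * X i                                      ≡⟨ sym (+-identityʳ _) ⟩
      a i * X i + 0ℚ                                 ≡⟨ cong (a i * X i +_) (sym (sum-zero restVanish)) ⟩
      a i * X i + sumFin (λ l → a (punchIn i l) * X (punchIn i l))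
                                                     ≡⟨ sym (sum-punchIn i (λ l → a l * X l)) ⟩
      dot a X                                        ≡⟨ dot-combo a c v ⟩
      sumFin (λ j → c j * dot a (v j))               ≡⟨ sum-zero (λ j → trans (cong (c j *_) (normal j)) (*-zeroʳ (c j))) ⟩
      0ℚ                                             ∎)
      where
        open ≡-Reasoning
        X : Point (suc m)
        X = combo c v
        restVanish : ∀ l → a (punchIn i l) * X (punchIn i l) ≡ 0ℚ
        restVanish l = trans (cong (a (punchIn i l) *_) (rest l)) (*-zeroʳ (a (punchIn i l)))

hyperplane-dim : ∀ {d} (F : Region d) (a : Point d) (b : ℚ) (i : Fin d) →
  a i ≢ 0ℚ → (∀ y → F y → dot a y ≡ b) → ¬ HasAffIndep F (suc d)
hyperplane-dim {suc m} F a b i aᵢ≢0 inH independent =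
  affIndep-bound (Forget i F) (hyperplane-forget F a b i aᵢ≢0 inH independent)

twoCoordinates-dim : ∀ {d} (F : Region d) (i l : Fin d) → i ≢ l →
  (∀ y → F y → y i ≡ 0ℚ) → (∀ y → F y → y l ≡ 0ℚ) → ¬ HasAffIndep F d
twoCoordinates-dim {suc zero} F zero zero i≢l _ _ _ = i≢l refl
twoCoordinates-dim {suc (suc m)} F i l i≢l yᵢ≡0 yₗ≡0 independent =
  hyperplane-dim (Forget i F) (unit l′) 0ℚ l′ (λ 1≡0 → 1≢0 (trans (sym (unit-self l′)) 1≡0)) forgotten
    (hyperplane-forget F (unit i) 0ℚ i (λ 1≡0 → 1≢0 (trans (sym (unit-self i)) 1≡0))
                       (λ y y∈F → trans (dot-unitˡ i y) (yᵢ≡0 y y∈F)) independent)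
  where
    l′ : Fin (suc m)
    l′ = punchOut i≢l
    forgotten : ∀ z → Forget i F z → dot (unit l′) z ≡ 0ℚ
    forgotten z (y , y∈F , z≡y) = begin
      dot (unit l′) z       ≡⟨ dot-unitˡ l′ z ⟩
      z l′                  ≡⟨ z≡y l′ ⟩
      y (punchIn i l′)      ≡⟨ cong y (punchIn-punchOut i≢l) ⟩
      y l                   ≡⟨ yₗ≡0 y y∈F ⟩
      0ℚ                    ∎
      where open ≡-Reasoning

pair : ∀ {d} → Fin d → Fin d → Fin d → Bool
pair u l x = singleton u x ∨ singleton l x

pair-member : ∀ {d} {u l x : Fin d} → pair u l x ≡ true → u ≡ x ⊎ l ≡ x
pair-member {u = u} {l} {x} _ with singleton u x in ux
... | true  = inj₁ (singleton-member ux)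
pair-member {u = u} {l} {x} lx | false = inj₂ (singleton-member lx)

pair-left : ∀ {d} (u l : Fin d) → pair u l u ≡ true
pair-left u l rewrite singleton-self u = refl

pair-right : ∀ {d} (u l : Fin d) → pair u l l ≡ true
pair-right u l with singleton u l
... | true  = refl
... | false = singleton-self l

pair-outside : ∀ {d} {u l x : Fin d} → u ≢ x → l ≢ x → pair u l x ≡ false
pair-outside u≢x l≢x rewrite singleton-other u≢x | singleton-other l≢x = refl

stable-empty : ∀ {d} (G : Graph d) → IsStable G (λ _ → false)
stable-empty G u v _ (() , _)

stable-singleton : ∀ {d} (G : Graph d) (i : Fin d) → IsStable G (singleton i)
stable-singleton G i u v uv (iu , iv)
  with refl ← singleton-member {i = i} {u} iu | refl ← singleton-member {i = i} {v} iv = irrefl G uv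

stable-pair : ∀ {d} (G : Graph d) (u l : Fin d) → ¬ Adj G u l → IsStable G (pair u l)
stable-pair G u l ¬ul x y xy (ux , uy) with pair-member {u = u} {l} {x} ux | pair-member {u = u} {l} {y} uy
... | inj₁ refl | inj₁ refl = irrefl G xy
... | inj₁ refl | inj₂ refl = ¬ul xy
... | inj₂ refl | inj₁ refl = ¬ul (Graph.sym G xy)
... | inj₂ refl | inj₂ refl = irrefl G xy

stable-edge : ∀ {d} (G : Graph d) (S : Fin d → Bool) → IsStable G S →
  ∀ {u w} → Adj G u w → χ S u + χ S w ≤ 1ℚ
stable-edge G S stable {u} {w} uw =
  subst (_≤ 1ℚ) (sym (cong₂ _+_ (χ≡bit S u) (χ≡bit S w))) (bits (S u) (S w) (stable u w uw))
  where
    bits : ∀ a b → ¬ (a ≡ true × b ≡ true) → bit a + bit b ≤ 1ℚ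
    bits true  true  notBoth = contradiction (refl , refl) notBoth
    bits true  false _       = ≤-refl
    bits false true  _       = ≤-refl
    bits false false _       = 0≤1

χ∈STAB : ∀ {d} (G : Graph d) S → IsStable G S → STAB G (χ S)
χ∈STAB G S stable = 1 , (λ _ → S) , (λ _ → stable) , (λ _ → 1ℚ) , (λ _ → 0≤1) , +-identityʳ 1ℚ ,
  λ i → sym (trans (+-identityʳ _) (*-identityˡ _))

zero∈STAB : ∀ {d} (G : Graph d) → STAB G (zeroPt d)
zero∈STAB G with k , S , stable , c , c≥0 , Σc≡1 , x≡ ← χ∈STAB G _ (stable-empty G) =
  k , S , stable , c , c≥0 , Σc≡1 , λ i → trans (sym (χ-false (λ _ → false) {i} refl)) (x≡ i)

unit∈STAB : ∀ {d} (G : Graph d) (i : Fin d) → STAB G (unit i)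
unit∈STAB G i = χ∈STAB G (singleton i) (stable-singleton G i)

STAB-nonNeg : ∀ {d} (G : Graph d) {y : Point d} → STAB G y → ∀ i → 0ℚ ≤ y i
STAB-nonNeg G (k , S , stable , c , c≥0 , Σc≡1 , y≡) i =
  subst (0ℚ ≤_) (sym (y≡ i)) (sum-nonNeg (λ j → *-nonNeg (c≥0 j) (χ-nonNeg (S j) i)))

STAB-edge : ∀ {d} (G : Graph d) {y : Point d} → STAB G y → ∀ {u w} → Adj G u w → y u + y w ≤ 1ℚ
STAB-edge G (k , S , stable , c , c≥0 , Σc≡1 , y≡) {u} {w} uw = begin
  _                                                     ≡⟨ cong₂ _+_ (y≡ u) (y≡ w) ⟩
  sumFin (λ j → c j * χ (S j) u) + sumFin (λ j → c j * χ (S j) w)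
                                                        ≡⟨ sym (sum-+ (λ j → c j * χ (S j) u) (λ j → c j * χ (S j) w)) ⟩
  sumFin (λ j → c j * χ (S j) u + c j * χ (S j) w)      ≡⟨ sum-cong (λ j → sym (*-distribˡ-+ (c j) _ _)) ⟩
  sumFin (λ j → c j * (χ (S j) u + χ (S j) w))          ≤⟨ sum-mono (λ j → *-monoˡ-≤-nonNeg (c j) {{nonNegative (c≥0 j)}}
                                                                             (stable-edge G (S j) (stable j) uw)) ⟩
  sumFin (λ j → c j * 1ℚ)                               ≡⟨ sum-cong (λ j → *-identityʳ (c j)) ⟩
  sumFin c                                              ≡⟨ Σc≡1 ⟩
  1ℚ                                                    ∎
  where open ≤-Reasoning

-- STAB(G) is full-dimensional: it contains 0 and e_1, ..., e_d.
STAB-fullDim : ∀ {d} (G : Graph d) (F : Region d) → (∀ y → STAB G y → F y) → HasAffIndep F (suc d)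
STAB-fullDim {d} G F STAB⊆F =
  points , onF , diagonal (differences points) (λ j → j)
                          (λ j → trans (+-identityʳ _) (unit-self j))
                          (λ j j' j'≢j → trans (+-identityʳ _) (unit-other j'≢j))
  where
    points : Fin (suc d) → Point d
    points zero    = zeroPt d
    points (suc j) = unit j
    onF : ∀ j → F (points j)
    onF zero    = STAB⊆F _ (zero∈STAB G)
    onF (suc j) = STAB⊆F _ (unit∈STAB G j)

-- Facets of STAB(G): the nonnegativity facets, and the edge facets when G is bipartite

-- a valid inequality with a nonzero normal whose face contains d affinely independent points
-- defines a facet, since the face lies in the hyperplane a · y = b
facet-intro : ∀ {d} {P : Region d} {a : Point d} {b : ℚ} (i : Fin d) → a i ≢ 0ℚ →
  ValidIneq P a b → HasAffIndep (Face P a b) d → IsFacet P a b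
facet-intro {P = P} {a} {b} i aᵢ≢0 valid independent =
  valid , independent , hyperplane-dim (Face P a b) a b i aᵢ≢0 (λ _ → proj₂)

NonnegFace : ∀ {d} → Graph d → Fin d → Region d
NonnegFace G i = Face (STAB G) (negUnit i) 0ℚ

EdgeFace : ∀ {d} → Graph d → Fin d → Fin d → Region d
EdgeFace G u w = Face (STAB G) (edgeVec u w) 1ℚ

nonnegFace-intro : ∀ {d} (G : Graph d) (i : Fin d) {y} → STAB G y → y i ≡ 0ℚ → NonnegFace G i y
nonnegFace-intro G i {y} y∈P yᵢ≡0 = y∈P , trans (dot-negUnit i y) (cong -_ yᵢ≡0)

nonnegFace-coordinate : ∀ {d} (G : Graph d) (i : Fin d) {y} → NonnegFace G i y → y i ≡ 0ℚ
nonnegFace-coordinate G i {y} (_ , onH) = neg-injective (trans (sym (dot-negUnit i y)) onH)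

edgeFace-intro : ∀ {d} (G : Graph d) (u w : Fin d) {y} → STAB G y → y u + y w ≡ 1ℚ → EdgeFace G u w y
edgeFace-intro G u w {y} y∈P tight = y∈P , trans (dot-edgeVec u w y) tight

edgeFace-tight : ∀ {d} (G : Graph d) (u w : Fin d) {y} → EdgeFace G u w y → y u + y w ≡ 1ℚ
edgeFace-tight G u w {y} (_ , onH) = trans (sym (dot-edgeVec u w y)) onH

-- The nonnegativity inequality -y_i ≤ 0 defines a facet: its face contains 0 and e_l for l ≠ i.
nonnegFacet : ∀ {d} (G : Graph d) (i : Fin d) → IsFacet (STAB G) (negUnit i) 0ℚ
nonnegFacet {suc k} G i =
  facet-intro {a = negUnit i} i (λ -1≡0 → -1≢0 (trans (cong -_ (sym (unit-self i))) -1≡0)) valid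
    (points , onFace , diagonal (differences points) (punchIn i)
                         (λ j → trans (+-identityʳ _) (unit-self (punchIn i j)))
                         (λ j j' j'≢j → trans (+-identityʳ _) (unit-other (j'≢j ∘ punchIn-injective i j' j))))
  where
    -1≢0 : - 1ℚ ≢ 0ℚ
    -1≢0 ()
    valid : ValidIneq (STAB G) (negUnit i) 0ℚ
    valid y y∈P = subst (_≤ 0ℚ) (sym (dot-negUnit i y)) (neg-antimono-≤ (STAB-nonNeg G y∈P i))
    points : Fin (suc k) → Point (suc k)
    points zero    = zeroPt _
    points (suc j) = unit (punchIn i j)
    onFace : ∀ j → NonnegFace G i (points j)
    onFace zero    = nonnegFace-intro G i (zero∈STAB G) refl
    onFace (suc j) = nonnegFace-intro G i (unit∈STAB G (punchIn i j)) (unit-other (punchInᵢ≢i i j))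

record Companion {d} (G : Graph d) (u w l : Fin d) : Set where
  field
    set      : Fin d → Bool
    stable   : IsStable G set
    contains : set l ≡ true
    within   : ∀ x → set x ≡ true → l ≡ x ⊎ u ≡ x ⊎ w ≡ x
    tight    : χ set u + χ set w ≡ 1ℚ

two-colours : ∀ {a b c : Bool} → a ≢ c → b ≢ c → a ≡ b
two-colours {false} {false}         _   _   = refl
two-colours {true}  {true}          _   _   = refl
two-colours {false} {true}  {false} a≢c _   = contradiction refl a≢c
two-colours {false} {true}  {true}  _   b≢c = contradiction refl b≢c
two-colours {true}  {false} {false} _   b≢c = contradiction refl b≢c
two-colours {true}  {false} {true}  a≢c _   = contradiction refl a≢c

-- In a bipartite graph every node l ≠ u has a companion for the edge uw: {w} if l = w, {u, l}
-- if l has the colour of u (so is not adjacent to u), and {w, l} otherwise.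
companion : ∀ {d} (G : Graph d) → Bipartite G → ∀ {u w} → Adj G u w → ∀ l → l ≢ u → Companion G u w l
companion G (colour , proper) {u} {w} uw l l≢u with l ≟ᶠ w
... | yes refl = record
  { set      = singleton l
  ; stable   = stable-singleton G l
  ; contains = singleton-self l
  ; within   = λ x lx → inj₂ (inj₂ (singleton-member lx))
  ; tight    = trans (cong₂ _+_ (unit-other l≢u) (unit-self l)) (+-identityˡ 1ℚ)
  }
... | no l≢w with colour l ≟ᵇ colour u
...   | yes sameColour = record
  { set      = pair u l
  ; stable   = stable-pair G u l (λ ul → proper u l ul (sym sameColour))
  ; contains = pair-right u l
  ; within   = λ x ulx → swap (pair-member {u = u} {l} {x} ulx)
  ; tight    = trans (cong₂ _+_ (χ-true (pair u l) (pair-left u l)) (χ-false (pair u l) (pair-outside u≢w l≢w)))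
                     (+-identityʳ 1ℚ)
  }
  where
    u≢w : u ≢ w
    u≢w refl = irrefl G uw
    swap : ∀ {x} → u ≡ x ⊎ l ≡ x → l ≡ x ⊎ u ≡ x ⊎ w ≡ x
    swap (inj₁ u≡x) = inj₂ (inj₁ u≡x)
    swap (inj₂ l≡x) = inj₁ l≡x
...   | no otherColour = record
  { set      = pair w l
  ; stable   = stable-pair G w l (λ wl → proper w l wl (sym (two-colours otherColour (λ wu → proper u w uw (sym wu)))))
  ; contains = pair-right w l
  ; within   = λ x wlx → swap (pair-member {u = w} {l} {x} wlx)
  ; tight    = trans (cong₂ _+_ (χ-false (pair w l) (pair-outside (λ w≡u → irrefl G (subst (Adj G u) w≡u uw)) l≢u))
                                (χ-true (pair w l) (pair-left w l)))
                     (+-identityˡ 1ℚ)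
  }
  where
    swap : ∀ {x} → w ≡ x ⊎ l ≡ x → l ≡ x ⊎ u ≡ x ⊎ w ≡ x
    swap (inj₁ w≡x) = inj₂ (inj₂ w≡x)
    swap (inj₂ l≡x) = inj₁ l≡x

-- In a bipartite graph the edge inequality y_u + y_w ≤ 1 defines a facet: its face contains e_u
-- and the companions of all l ≠ u, and the companion of l is the only one of these containing l
-- unless l = w.
edgeFacet : ∀ {d} (G : Graph d) → Bipartite G → ∀ {u w} → Adj G u w → IsFacet (STAB G) (edgeVec u w) 1ℚ
edgeFacet {suc k} G bipartite {u} {w} uw =
  facet-intro {a = edgeVec u w} u (λ 1≡0 → 1≢0 (trans (sym normalᵤ) 1≡0)) valid
    (points , onFace , almostDiagonal (differences points) (punchIn u) (punchOut u≢w) one zeros)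
  where
    open Companion
    u≢w : u ≢ w
    u≢w refl = irrefl G uw
    normalᵤ : unit u u + unit w u ≡ 1ℚ
    normalᵤ = trans (cong₂ _+_ (unit-self u) (unit-other (λ w≡u → u≢w (sym w≡u)))) (+-identityʳ 1ℚ)
    eᵤ-tight : unit u u + unit u w ≡ 1ℚ
    eᵤ-tight = trans (cong₂ _+_ (unit-self u) (unit-other u≢w)) (+-identityʳ 1ℚ)
    valid : ValidIneq (STAB G) (edgeVec u w) 1ℚ
    valid y y∈P = subst (_≤ 1ℚ) (sym (dot-edgeVec u w y)) (STAB-edge G y∈P uw)
    T : ∀ j → Companion G u w (punchIn u j)
    T j = companion G bipartite uw (punchIn u j) (punchInᵢ≢i u j)
    points : Fin (suc k) → Point (suc k)
    points zero    = unit u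
    points (suc j) = χ (set (T j))
    onFace : ∀ j → EdgeFace G u w (points j)
    onFace zero    = edgeFace-intro G u w (unit∈STAB G u) eᵤ-tight
    onFace (suc j) = edgeFace-intro G u w (χ∈STAB G (set (T j)) (stable (T j))) (tight (T j))
    one : ∀ j → differences points j (punchIn u j) ≡ 1ℚ
    one j = trans (cong₂ _-_ (χ-true (set (T j)) (contains (T j))) (unit-other (λ u≡ → punchInᵢ≢i u j (sym u≡))))
                  (+-identityʳ 1ℚ)
    absent : ∀ j j' → j ≢ punchOut u≢w → j' ≢ j → set (T j') (punchIn u j) ≡ false
    absent j j' j≢j₀ j'≢j with set (T j') (punchIn u j) in member
    ... | false = refl
    ... | true with within (T j') (punchIn u j) member
    ...   | inj₁ same        = contradiction (punchIn-injective u j' j same) j'≢j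
    ...   | inj₂ (inj₁ u≡)   = contradiction (sym u≡) (punchInᵢ≢i u j)
    ...   | inj₂ (inj₂ w≡)   =
      contradiction (punchIn-injective u j (punchOut u≢w) (trans (sym w≡) (sym (punchIn-punchOut u≢w)))) j≢j₀
    zeros : ∀ j j' → j ≢ punchOut u≢w → j' ≢ j → differences points j' (punchIn u j) ≡ 0ℚ
    zeros j j' j≢j₀ j'≢j =
      trans (cong₂ _-_ (χ-false (set (T j')) (absent j j' j≢j₀ j'≢j)) (unit-other (λ u≡ → punchInᵢ≢i u j (sym u≡))))
            (+-identityʳ 0ℚ)

zero∈nonnegFace : ∀ {d} (G : Graph d) (l : Fin d) → NonnegFace G l (zeroPt d)
zero∈nonnegFace G l = nonnegFace-intro G l (zero∈STAB G) refl

zero∉edgeFace : ∀ {d} (G : Graph d) (u w : Fin d) → ¬ EdgeFace G u w (zeroPt d)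
zero∉edgeFace G u w onFace = 1≢0 (trans (sym (edgeFace-tight G u w onFace)) (+-identityʳ 0ℚ))

unit∈nonnegFace : ∀ {d} (G : Graph d) {p l : Fin d} → p ≢ l → NonnegFace G l (unit p)
unit∈nonnegFace G {p} {l} p≢l = nonnegFace-intro G l (unit∈STAB G p) (unit-other p≢l)

unit∉nonnegFace : ∀ {d} (G : Graph d) (l : Fin d) → ¬ NonnegFace G l (unit l)
unit∉nonnegFace G l onFace = 1≢0 (trans (sym (unit-self l)) (nonnegFace-coordinate G l onFace))

unit∈edgeFaceˡ : ∀ {d} (G : Graph d) {u w : Fin d} → u ≢ w → EdgeFace G u w (unit u)
unit∈edgeFaceˡ G {u} {w} u≢w =
  edgeFace-intro G u w (unit∈STAB G u) (trans (cong₂ _+_ (unit-self u) (unit-other u≢w)) (+-identityʳ 1ℚ))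

unit∈edgeFaceʳ : ∀ {d} (G : Graph d) {u w : Fin d} → u ≢ w → EdgeFace G u w (unit w)
unit∈edgeFaceʳ G {u} {w} u≢w =
  edgeFace-intro G u w (unit∈STAB G w)
    (trans (cong₂ _+_ (unit-other (λ w≡u → u≢w (sym w≡u))) (unit-self w)) (+-identityˡ 1ℚ))

unit∉edgeFace : ∀ {d} (G : Graph d) {p u w : Fin d} → p ≢ u → p ≢ w → ¬ EdgeFace G u w (unit p)
unit∉edgeFace G {p} {u} {w} p≢u p≢w onFace =
  1≢0 (trans (sym (edgeFace-tight G u w onFace)) (trans (cong₂ _+_ (unit-other p≢u) (unit-other p≢w)) (+-identityʳ 0ℚ)))

SameSet-sym : ∀ {d} {A B : Region d} → SameSet A B → SameSet B A
SameSet-sym A≈B y = proj₂ (A≈B y) , proj₁ (A≈B y)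

SameSet-trans : ∀ {d} {A B C : Region d} → SameSet A B → SameSet B C → SameSet A C
SameSet-trans A≈B B≈C y = (λ Ay → proj₁ (B≈C y) (proj₁ (A≈B y) Ay)) , (λ Cy → proj₂ (A≈B y) (proj₂ (B≈C y) Cy))

separated : ∀ {d} {A B : Region d} y → A y → ¬ B y → ¬ SameSet A B
separated y Ay ¬By A≈B = ¬By (proj₁ (A≈B y) Ay)

nonnegFace-injective : ∀ {d} (G : Graph d) (i i' : Fin d) → SameSet (NonnegFace G i) (NonnegFace G i') → i ≡ i'
nonnegFace-injective G i i' same with i ≟ᶠ i'
... | yes i≡i' = i≡i'
... | no i≢i'  = contradiction same
                   (separated (unit i') (unit∈nonnegFace G (λ i'≡i → i≢i' (sym i'≡i))) (unit∉nonnegFace G i'))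

-- The origin is a simple vertex

zero-isVertex : ∀ {d} (G : Graph d) → IsVertex (STAB G) (zeroPt d)
zero-isVertex G = zero∈STAB G , extreme
  where
    extreme : ∀ y z t → STAB G y → STAB G z → 0ℚ < t → t < 1ℚ →
      (∀ i → 0ℚ ≡ t * y i + (1ℚ - t) * z i) → ∀ i → y i ≡ z i
    extreme y z t y∈P z∈P 0<t t<1 0≡ i = trans yᵢ≡0 (sym zᵢ≡0)
      where
        ty≥0 : 0ℚ ≤ t * y i
        ty≥0 = *-nonNeg (<⇒≤ 0<t) (STAB-nonNeg G y∈P i)
        sz≥0 : 0ℚ ≤ (1ℚ - t) * z i
        sz≥0 = *-nonNeg (<⇒≤ (1-pos t<1)) (STAB-nonNeg G z∈P i)
        yᵢ≡0 : y i ≡ 0ℚ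
        yᵢ≡0 = *-cancel-nonZero (λ t≡0 → <⇒≢ 0<t (sym t≡0)) (nonNeg-sum-zeroˡ ty≥0 sz≥0 (sym (0≡ i)))
        zᵢ≡0 : z i ≡ 0ℚ
        zᵢ≡0 = *-cancel-nonZero (λ s≡0 → <⇒≢ (1-pos t<1) (sym s≡0)) (nonNeg-sum-zeroʳ ty≥0 sz≥0 (sym (0≡ i)))

-- If a · y ≤ 0 is valid for STAB(G), then a ≤ 0 (test it at e_l), so on the face a · y = 0 the
-- nonpositive terms a_l y_l all vanish: points of the face vanish on the support of a.
face-vanishesOnSupport : ∀ {d} (G : Graph d) (a : Point d) {b : ℚ} → b ≡ 0ℚ → ValidIneq (STAB G) a b →
  ∀ y → Face (STAB G) a b y → ∀ l → a l ≢ 0ℚ → y l ≡ 0ℚ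
face-vanishesOnSupport G a {b} b≡0 valid y (y∈P , a·y≡b) l aₗ≢0 =
  *-cancel-nonZero aₗ≢0 (neg-injective (sum-nonNeg-zero terms≥0 Σ≡0 l))
  where
    a≤0 : ∀ l → a l ≤ 0ℚ
    a≤0 l = subst₂ _≤_ (dot-unitʳ a l) b≡0 (valid (unit l) (unit∈STAB G l))
    terms≥0 : ∀ l → 0ℚ ≤ - (a l * y l)
    terms≥0 l = subst (0ℚ ≤_) (sym (neg-distribˡ-* (a l) (y l)))
                      (*-nonNeg (neg-antimono-≤ (a≤0 l)) (STAB-nonNeg G y∈P l))
    Σ≡0 : sumFin (λ l → - (a l * y l)) ≡ 0ℚ
    Σ≡0 = trans (sum-neg (λ l → a l * y l)) (cong -_ (trans a·y≡b b≡0))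

-- Here b = 0, and the normal has
-- exactly one nonzero entry a_i: none would make the face all of STAB(G), two would confine it to
-- two coordinate hyperplanes.  Then the face is {y ∈ STAB(G) | y_i = 0}.
facetThroughZero : ∀ {d} (G : Graph d) a b → IsFacet (STAB G) a b → Face (STAB G) a b (zeroPt d) →
  ∃ λ i → SameSet (Face (STAB G) a b) (NonnegFace G i)
facetThroughZero {d} G a b (valid , independent , notFull) (_ , a·0≡b) = classify (nonZero-or-zero a)
  where
    b≡0 : b ≡ 0ℚ
    b≡0 = trans (sym a·0≡b) (dot-zero a)
    onSupport : ∀ y → Face (STAB G) a b y → ∀ l → a l ≢ 0ℚ → y l ≡ 0ℚ
    onSupport = face-vanishesOnSupport G a b≡0 valid
    classify : (∃ λ i → a i ≢ 0ℚ) ⊎ (∀ i → a i ≡ 0ℚ) → ∃ λ i → SameSet (Face (STAB G) a b) (NonnegFace G i)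
    classify (inj₂ a≡0) = contradiction (STAB-fullDim G (Face (STAB G) a b) (λ y y∈P → y∈P , a·y≡b y)) notFull
      where
        a·y≡b : ∀ y → dot a y ≡ b
        a·y≡b y = trans (sum-zero (λ l → trans (cong (_* y l) (a≡0 l)) (*-zeroˡ (y l)))) (sym b≡0)
    classify (inj₁ (i , aᵢ≢0)) with nonZero-elsewhere a i
    ... | inj₁ (l , l≢i , aₗ≢0) =
      contradiction independent
        (twoCoordinates-dim (Face (STAB G) a b) i l (λ i≡l → l≢i (sym i≡l))
                            (λ y onFace → onSupport y onFace i aᵢ≢0) (λ y onFace → onSupport y onFace l aₗ≢0))
    ... | inj₂ a≡0elsewhere = i , λ y → toNonneg y , fromNonneg y
      where
        toNonneg : ∀ y → Face (STAB G) a b y → NonnegFace G i y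
        toNonneg y onFace = nonnegFace-intro G i (proj₁ onFace) (onSupport y onFace i aᵢ≢0)
        fromNonneg : ∀ y → NonnegFace G i y → Face (STAB G) a b y
        fromNonneg y onFace = proj₁ onFace , (begin
          dot a y    ≡⟨ sum-single i (λ l → a l * y l) (λ l l≢i → trans (cong (_* y l) (a≡0elsewhere l l≢i)) (*-zeroˡ (y l))) ⟩
          a i * y i  ≡⟨ cong (a i *_) (nonnegFace-coordinate G i onFace) ⟩
          a i * 0ℚ   ≡⟨ *-zeroʳ (a i) ⟩
          0ℚ         ≡⟨ sym b≡0 ⟩
          b          ∎)
          where open ≡-Reasoning

zero-inExactlyFacets : ∀ {d} (G : Graph d) → InExactlyFacets (STAB G) (zeroPt d) d
zero-inExactlyFacets G =
  (λ i → negUnit i , 0ℚ) , (λ i → nonnegFacet G i , zero∈nonnegFace G i) ,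
  nonnegFace-injective G , facetThroughZero G

-- Vertices of STAB(G) are characteristic vectors of stable sets

peel : ∀ {k} → (Fin k → ℚ) → Fin k → Fin k → ℚ
peel c j l = c l + (- c j) * unit j l

peel-nonNeg : ∀ {k} {c : Fin k → ℚ} → (∀ l → 0ℚ ≤ c l) → ∀ j l → 0ℚ ≤ peel c j l
peel-nonNeg {c = c} c≥0 j l with l ≟ᶠ j
... | yes refl = subst (0ℚ ≤_) (sym (begin
  c l + (- c l) * unit l l ≡⟨ cong (λ e → c l + (- c l) * e) (unit-self l) ⟩
  c l + (- c l) * 1ℚ       ≡⟨ cong (c l +_) (*-identityʳ (- c l)) ⟩
  c l - c l                ≡⟨ +-inverseʳ (c l) ⟩
  0ℚ                       ∎)) ≤-refl
  where open ≡-Reasoning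
... | no l≢j = subst (0ℚ ≤_) (sym (begin
  c l + (- c j) * unit j l ≡⟨ cong (λ e → c l + (- c j) * e) (unit-other (λ j≡l → l≢j (sym j≡l))) ⟩
  c l + (- c j) * 0ℚ       ≡⟨ cong (c l +_) (*-zeroʳ (- c j)) ⟩
  c l + 0ℚ                 ≡⟨ +-identityʳ (c l) ⟩
  c l                      ∎)) (c≥0 l)
  where open ≡-Reasoning

peel-sum : ∀ {k} (c : Fin k → ℚ) j → sumFin (peel c j) ≡ sumFin c - c j
peel-sum c j = begin
  sumFin (peel c j)                       ≡⟨ sum-linear (- c j) c (unit j) ⟩
  sumFin c + (- c j) * sumFin (unit j)    ≡⟨ cong (λ e → sumFin c + (- c j) * e) Σunit ⟩
  sumFin c + (- c j) * 1ℚ                 ≡⟨ cong (sumFin c +_) (*-identityʳ (- c j)) ⟩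
  sumFin c - c j                          ∎
  where
    open ≡-Reasoning
    Σunit : sumFin (unit j) ≡ 1ℚ
    Σunit = trans (sum-single j (unit j) (λ l l≢j → unit-other (λ j≡l → l≢j (sym j≡l)))) (unit-self j)

peel-combo : ∀ {k m} (c : Fin k → ℚ) j (v : Fin k → Point m) i →
  combo (peel c j) v i ≡ combo c v i + (- c j) * v j i
peel-combo c j v i = begin
  sumFin (λ l → (c l + (- c j) * unit j l) * v l i)
    ≡⟨ sum-cong (λ l → solve 4 (λ c t e v → (c :+ t :* e) :* v := c :* v :+ t :* (e :* v)) refl
                                (c l) (- c j) (unit j l) (v l i)) ⟩
  sumFin (λ l → c l * v l i + (- c j) * (unit j l * v l i))
    ≡⟨ sum-linear (- c j) (λ l → c l * v l i) (λ l → unit j l * v l i) ⟩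
  combo c v i + (- c j) * dot (unit j) (λ l → v l i)
    ≡⟨ cong (λ e → combo c v i + (- c j) * e) (dot-unitˡ j (λ l → v l i)) ⟩
  combo c v i + (- c j) * v j i ∎
  where open ≡-Reasoning

rescale : ∀ {d k} (G : Graph d) (S : Fin k → Fin d → Bool) → (∀ l → IsStable G (S l)) →
  (w : Fin k → ℚ) → (∀ l → 0ℚ ≤ w l) → 0ℚ < sumFin w →
  Σ (Point d) λ z → STAB G z × (∀ i → sumFin w * z i ≡ combo w (χ ∘ S) i)
rescale {d} {k} G S stable w w≥0 Σw>0 =
  combo weight (χ ∘ S) , (k , S , stable , weight , weight≥0 , Σweight≡1 , λ i → refl) , unscale
  where
    s r : ℚ
    s = sumFin w
    instance
      s>0 : Positive s
      s>0 = positive Σw>0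
      s≢0 : NonZero s
      s≢0 = pos⇒nonZero s
    r = 1/ s
    weight : Fin k → ℚ
    weight l = w l * r
    weight≥0 : ∀ l → 0ℚ ≤ weight l
    weight≥0 l = *-nonNeg (w≥0 l) (<⇒≤ (positive⁻¹ r {{1/pos⇒pos s}}))
    Σweight≡1 : sumFin weight ≡ 1ℚ
    Σweight≡1 = trans (sum-*ʳ r w) (*-inverseʳ s)
    unscale : ∀ i → s * combo weight (χ ∘ S) i ≡ combo w (χ ∘ S) i
    unscale i = begin
      s * sumFin (λ l → w l * r * χ (S l) i)
        ≡⟨ cong (s *_) (sum-cong (λ l → solve 3 (λ a r h → a :* r :* h := a :* h :* r) refl (w l) r (χ (S l) i))) ⟩
      s * sumFin (λ l → w l * χ (S l) i * r)
        ≡⟨ cong (s *_) (sum-*ʳ r (λ l → w l * χ (S l) i)) ⟩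
      s * (X * r)
        ≡⟨ solve 3 (λ s X r → s :* (X :* r) := X :* (s :* r)) refl s X r ⟩
      X * (s * r)
        ≡⟨ trans (cong (X *_) (*-inverseʳ s)) (*-identityʳ X) ⟩
      X ∎
      where open ≡-Reasoning
            X : ℚ
            X = combo w (χ ∘ S) i

-- Splitting off one stable set: if x = Σ_l c_l χ(S_l) is a convex combination and c_j < 1, then
-- x = c_j χ(S_j) + (1 - c_j) z, where z rescales the remaining weights c - c_j e_j.
splitOff : ∀ {d k} (G : Graph d) (S : Fin k → Fin d → Bool) → (∀ l → IsStable G (S l)) →
  (c : Fin k → ℚ) → (∀ l → 0ℚ ≤ c l) → sumFin c ≡ 1ℚ → ∀ j → c j < 1ℚ →
  Σ (Point d) λ z → STAB G z × (∀ i → combo c (χ ∘ S) i ≡ c j * χ (S j) i + (1ℚ - c j) * z i)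
splitOff {d} G S stable c c≥0 Σc≡1 j cⱼ<1 = z , z∈P , split
  where
    Σpeel≡ : sumFin (peel c j) ≡ 1ℚ - c j
    Σpeel≡ = trans (peel-sum c j) (cong (_- c j) Σc≡1)
    rescaled : Σ (Point d) λ z → STAB G z × (∀ i → sumFin (peel c j) * z i ≡ combo (peel c j) (χ ∘ S) i)
    rescaled = rescale G S stable (peel c j) (peel-nonNeg c≥0 j) (<-respʳ-≡ (sym Σpeel≡) (1-pos cⱼ<1))
    z : Point d
    z = proj₁ rescaled
    z∈P : STAB G z
    z∈P = proj₁ (proj₂ rescaled)
    split : ∀ i → combo c (χ ∘ S) i ≡ c j * χ (S j) i + (1ℚ - c j) * z i
    split i = begin
      x                           ≡⟨ solve 3 (λ x t y → x := t :* y :+ (x :+ (:- t) :* y)) refl x (c j) y ⟩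
      c j * y + (x + (- c j) * y) ≡⟨ cong (c j * y +_) (sym (peel-combo c j (χ ∘ S) i)) ⟩
      c j * y + combo (peel c j) (χ ∘ S) i
                                  ≡⟨ cong (c j * y +_) (sym (proj₂ (proj₂ rescaled) i)) ⟩
      c j * y + sumFin (peel c j) * z i
                                  ≡⟨ cong (λ e → c j * y + e * z i) Σpeel≡ ⟩
      c j * y + (1ℚ - c j) * z i  ∎
      where
        open ≡-Reasoning
        x y : ℚ
        x = combo c (χ ∘ S) i
        y = χ (S j) i

-- Every vertex x of STAB(G) is the characteristic vector of a stable set: write x as a convex
-- combination and pick a positive coefficient c_j; either c_j = 1, or splitting off S_j writes x
-- as a proper convex combination of χ(S_j) and another point, which must then equal χ(S_j).
vertex-characteristic : ∀ {d} (G : Graph d) {x : Point d} → IsVertex (STAB G) x →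
  Σ (Fin d → Bool) λ S → IsStable G S × (∀ i → x i ≡ χ S i)
vertex-characteristic {d} G {x} ((k , S , stable , c , c≥0 , Σc≡1 , x≡) , extreme) with nonZero-or-zero c
... | inj₂ c≡0 = contradiction (trans (sym Σc≡1) (sum-zero c≡0)) 1≢0
... | inj₁ (j , cⱼ≢0) with c j ≟ 1ℚ
...   | yes cⱼ≡1 = S j , stable j , λ i → trans (x≡ i) (onlyTerm i)
  where
    others≡0 : ∀ l → l ≢ j → c l ≡ 0ℚ
    others≡0 = weightOne-others c≥0 Σc≡1 j cⱼ≡1
    onlyTerm : ∀ i → combo c (χ ∘ S) i ≡ χ (S j) i
    onlyTerm i = trans (sum-single j (λ l → c l * χ (S l) i)
                                     (λ l l≢j → trans (cong (_* χ (S l) i) (others≡0 l l≢j)) (*-zeroˡ (χ (S l) i))))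
                       (trans (cong (_* χ (S j) i) cⱼ≡1) (*-identityˡ (χ (S j) i)))
...   | no cⱼ≢1 = S j , stable j , λ i → begin
  x i                                       ≡⟨ x≡ i ⟩
  combo c (χ ∘ S) i                         ≡⟨ split i ⟩
  c j * χ (S j) i + (1ℚ - c j) * z i        ≡⟨ cong (λ e → c j * χ (S j) i + (1ℚ - c j) * e) (sym (χⱼ≡z i)) ⟩
  c j * χ (S j) i + (1ℚ - c j) * χ (S j) i  ≡⟨ solve 2 (λ t y → t :* y :+ (con 1ℚ :- t) :* y := y) refl (c j) (χ (S j) i) ⟩
  χ (S j) i                                 ∎
  where
    open ≡-Reasoning
    0<cⱼ : 0ℚ < c j
    0<cⱼ = ≤∧≢⇒< (c≥0 j) (λ 0≡cⱼ → cⱼ≢0 (sym 0≡cⱼ))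
    cⱼ<1 : c j < 1ℚ
    cⱼ<1 = ≤∧≢⇒< (subst (c j ≤_) Σc≡1 (term≤sum c≥0 j)) cⱼ≢1
    decomposition : Σ (Point d) λ z → STAB G z × (∀ i → combo c (χ ∘ S) i ≡ c j * χ (S j) i + (1ℚ - c j) * z i)
    decomposition = splitOff G S stable c c≥0 Σc≡1 j cⱼ<1
    z : Point d
    z = proj₁ decomposition
    split : ∀ i → combo c (χ ∘ S) i ≡ c j * χ (S j) i + (1ℚ - c j) * z i
    split = proj₂ (proj₂ decomposition)
    -- x is a proper convex combination of χ(S_j) and z, so these coincide
    χⱼ≡z : ∀ i → χ (S j) i ≡ z i
    χⱼ≡z = extreme (χ (S j)) z (c j) (χ∈STAB G (S j) (stable j)) (proj₁ (proj₂ decomposition)) 0<cⱼ cⱼ<1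
                   (λ i → trans (x≡ i) (split i))

-- A nonzero vertex lies on more than d facets

FaceOf : ∀ {d} → Region d → Point d × ℚ → Region d
FaceOf P (a , b) = Face P a b

IsFacetOf : ∀ {d} → Region d → Point d × ℚ → Set
IsFacetOf P (a , b) = IsFacet P a b

-- If x lies in exactly n facets, then a family of facets through x with pairwise different faces
-- has at most n members: otherwise two of them would match the same listed facet.
facetFamily-bound : ∀ {d n m} {P : Region d} {x : Point d} → InExactlyFacets P x n →
  (family : Fin m → Point d × ℚ) → (∀ a → IsFacetOf P (family a) × FaceOf P (family a) x) →
  (∀ a a' → SameSet (FaceOf P (family a)) (FaceOf P (family a')) → a ≡ a') → m ℕ.≤ n
facetFamily-bound {n = n} {m} {P} (listed , _ , _ , cover) family through distinct = ℕ.≮⇒≥ tooMany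
  where
    match : ∀ a → ∃ λ j → SameSet (FaceOf P (family a)) (FaceOf P (listed j))
    match a = cover (proj₁ (family a)) (proj₂ (family a)) (proj₁ (through a)) (proj₂ (through a))
    tooMany : ¬ (n ℕ.< m)
    tooMany n<m with pigeonhole n<m (λ a → proj₁ (match a))
    ... | a , a' , a<a' , sameMatch =
      <⇒≢ᶠ a<a' (distinct a a' (SameSet-trans (proj₂ (match a))
        (subst (λ j → SameSet (FaceOf P (listed j)) (FaceOf P (family a'))) (sym sameMatch)
               (SameSet-sym (proj₂ (match a'))))))

-- A vertex x = χ(S) of STAB(G) with a node i ∈ S lies on d + 1 facets with different faces, if G
-- is bipartite with minimum degree 2.  A node l ∉ S gives the nonnegativity facet of l, a node
-- l ∈ S the edge facet of l and its first neighbour (which is not in S), and i also gives the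
-- edge facet of i and its second neighbour.  Test points 0 and e_p tell these faces apart.
module CrowdedVertex {d} (G : Graph d) (bipartite : Bipartite G) (minDegree : MinDegree≥2 G)
  {x : Point d} (x∈P : STAB G x) (S : Fin d → Bool) (stable : IsStable G S) (x≡χS : ∀ l → x l ≡ χ S l)
  (i : Fin d) (Sᵢ : S i ≡ true) where

  first second : Fin d → Fin d
  first v  = proj₁ (minDegree v)
  second v = proj₁ (proj₂ (minDegree v))

  first≢second : ∀ v → first v ≢ second v
  first≢second v = proj₁ (proj₂ (proj₂ (minDegree v)))

  adjFirst : ∀ v → Adj G v (first v)
  adjFirst v = proj₁ (proj₂ (proj₂ (proj₂ (minDegree v))))

  adjSecond : ∀ v → Adj G v (second v)
  adjSecond v = proj₂ (proj₂ (proj₂ (proj₂ (minDegree v))))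

  adj⇒≢ : ∀ {u w} → Adj G u w → u ≢ w
  adj⇒≢ uw refl = irrefl G uw

  neighbour∉S : ∀ {u w} → S u ≡ true → Adj G u w → S w ≡ false
  neighbour∉S {u} {w} Sᵤ uw with S w in Sw
  ... | true  = contradiction (Sᵤ , Sw) (stable u w uw)
  ... | false = refl

  in≢out : ∀ {p q} → S p ≡ true → S q ≡ false → p ≢ q
  in≢out Sp Sq refl with () ← trans (sym Sp) Sq

  nodeFacet : Bool → Fin d → Point d × ℚ
  nodeFacet true  l = edgeVec l (first l) , 1ℚ
  nodeFacet false l = negUnit l , 0ℚ

  family : Fin (suc d) → Point d × ℚ
  family zero    = edgeVec i (second i) , 1ℚ
  family (suc l) = nodeFacet (S l) l

  onEdgeFace : ∀ u w → S u ≡ true → Adj G u w → EdgeFace G u w x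
  onEdgeFace u w Sᵤ uw = edgeFace-intro G u w x∈P (begin
    x u + x w         ≡⟨ cong₂ _+_ (x≡χS u) (x≡χS w) ⟩
    χ S u + χ S w     ≡⟨ cong₂ _+_ (χ-true S Sᵤ) (χ-false S (neighbour∉S Sᵤ uw)) ⟩
    1ℚ + 0ℚ           ≡⟨ +-identityʳ 1ℚ ⟩
    1ℚ                ∎)
    where open ≡-Reasoning

  onNonnegFace : ∀ l → S l ≡ false → NonnegFace G l x
  onNonnegFace l Sₗ = nonnegFace-intro G l x∈P (trans (x≡χS l) (χ-false S Sₗ))

  nodeFacet-through : ∀ l b → S l ≡ b → IsFacetOf (STAB G) (nodeFacet b l) × FaceOf (STAB G) (nodeFacet b l) x
  nodeFacet-through l true  Sₗ = edgeFacet G bipartite (adjFirst l) , onEdgeFace l (first l) Sₗ (adjFirst l)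
  nodeFacet-through l false Sₗ = nonnegFacet G l , onNonnegFace l Sₗ

  family-through : ∀ a → IsFacetOf (STAB G) (family a) × FaceOf (STAB G) (family a) x
  family-through zero    = edgeFacet G bipartite (adjSecond i) , onEdgeFace i (second i) Sᵢ (adjSecond i)
  family-through (suc l) = nodeFacet-through l (S l) refl

  nodeFaces-differ : ∀ l l' → l ≢ l' → ∀ {b b'} → S l ≡ b → S l' ≡ b' →
    ¬ SameSet (FaceOf (STAB G) (nodeFacet b l)) (FaceOf (STAB G) (nodeFacet b' l'))
  nodeFaces-differ l l' l≢l' {true} {true} Sₗ Sₗ' =
    separated (unit l) (unit∈edgeFaceˡ G (adj⇒≢ (adjFirst l)))
              (unit∉edgeFace G l≢l' (in≢out Sₗ (neighbour∉S Sₗ' (adjFirst l'))))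
  nodeFaces-differ l l' l≢l' {true} {false} _ _ same =
    separated (zeroPt d) (zero∈nonnegFace G l') (zero∉edgeFace G l (first l)) (SameSet-sym same)
  nodeFaces-differ l l' l≢l' {false} {true} _ _ =
    separated (zeroPt d) (zero∈nonnegFace G l) (zero∉edgeFace G l' (first l'))
  nodeFaces-differ l l' l≢l' {false} {false} _ _ =
    separated (unit l') (unit∈nonnegFace G (λ l'≡l → l≢l' (sym l'≡l))) (unit∉nonnegFace G l')

  extraFace-differs : ∀ l {b} → S l ≡ b → ¬ SameSet (FaceOf (STAB G) (family zero)) (FaceOf (STAB G) (nodeFacet b l))
  extraFace-differs l {false} _ same =
    separated (zeroPt d) (zero∈nonnegFace G l) (zero∉edgeFace G i (second i)) (SameSet-sym same)
  extraFace-differs l {true} Sₗ with l ≟ᶠ i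
  ... | yes refl =
    separated (unit (second i)) (unit∈edgeFaceʳ G (adj⇒≢ (adjSecond i)))
              (unit∉edgeFace G (λ second≡i → adj⇒≢ (adjSecond i) (sym second≡i))
                               (λ second≡first → first≢second i (sym second≡first)))
  ... | no l≢i =
    separated (unit i) (unit∈edgeFaceˡ G (adj⇒≢ (adjSecond i)))
              (unit∉edgeFace G (λ i≡l → l≢i (sym i≡l)) (in≢out Sᵢ (neighbour∉S Sₗ (adjFirst l))))

  family-distinct : ∀ a a' → SameSet (FaceOf (STAB G) (family a)) (FaceOf (STAB G) (family a')) → a ≡ a'
  family-distinct zero    zero     _    = refl
  family-distinct zero    (suc l)  same = contradiction same (extraFace-differs l refl)
  family-distinct (suc l) zero     same = contradiction (SameSet-sym same) (extraFace-differs l refl)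
  family-distinct (suc l) (suc l') same with l ≟ᶠ l'
  ... | yes l≡l' = cong suc l≡l'
  ... | no l≢l'  = contradiction same (nodeFaces-differ l l' l≢l' refl refl)

-- A simple vertex of STAB(G) is the origin: a nonzero vertex lies on at least d + 1 facets.
simpleVertex-isZero : ∀ {d} (G : Graph d) → Bipartite G → MinDegree≥2 G →
  ∀ x → IsSimpleVertex (STAB G) x → ∀ i → x i ≡ 0ℚ
simpleVertex-isZero {d} G bipartite minDegree x (vertex , exactly) i with x i ≟ 0ℚ
... | yes xᵢ≡0 = xᵢ≡0
... | no xᵢ≢0  = contradiction (facetFamily-bound exactly family family-through family-distinct) (ℕ.n≮n d)
  where
    characteristic : Σ (Fin d → Bool) λ S → IsStable G S × (∀ l → x l ≡ χ S l)
    characteristic = vertex-characteristic G vertex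
    S : Fin d → Bool
    S = proj₁ characteristic
    x≡χS : ∀ l → x l ≡ χ S l
    x≡χS = proj₂ (proj₂ characteristic)
    Sᵢ : S i ≡ true
    Sᵢ with S i in Sᵢ
    ... | true  = refl
    ... | false = contradiction (trans (x≡χS i) (χ-false S Sᵢ)) xᵢ≢0
    open CrowdedVertex G bipartite minDegree (proj₁ vertex) S (proj₁ (proj₂ characteristic)) x≡χS i Sᵢ

claim3p1 : (d : ℕ) (G : Graph d) → Bipartite G → MinDegree≥2 G →
    IsSimpleVertex (STAB G) (zeroPt d) ×
    (∀ x → IsSimpleVertex (STAB G) x → ∀ i → x i ≡ 0ℚ)
claim3p1 d G bipartite minDegree =
  (zero-isVertex G , zero-inExactlyFacets G) , simpleVertex-isZero G bipartite minDegree
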